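{- Let $n$ be a positive integer and let $A = L\cup R$ where $L\subset[1,n]$ and $R\subset[n+1,2n]$, with $1,2n\in A$ and $n\notin A$. Suppose that $A$ is $P_n$ and MSTD. Let $A_1 = A$ and for $l \ge 1$ let $$A_{2l} = \big([(1-l)n,(l+1)n]\setminus\{n\}\big)\cup\{(l+2)n\}$$ and $$A_{2l+1} = (L-ln-1)\cup\big([(1-l)n,(l+1)n]\setminus\{n\}\big)\cup(R+ln).$$ Then $A_1\subset A_2\subset A_3\subset \cdots$, and this sequence of sets alternates between being MSTD and MDTS (the sets $A_{2l-1}$ are MSTD and the sets $A_{2l}$ are MDTS). Furthermore, for $m \ge 3$ the diameter of $A_m$ is $n$ larger than the diameter of $A_{m-1}$.
   Context: For a finite set of integers $A$, $A+A=\{a+b: a,b\in A\}$, $A-A=\{a-b: a,b\in A\}$; for an integer $t$, $A+t=\{a+t:a\in A\}$ and $A-t=\{a-t: a\in A\}$. For integers $x\le y$, $[x,y]=\{x,x+1,\dots,y\}$. A finite set $A$ is MSTD if $|A+A|>|A-A|$ and MDTS if $|A-A|>|A+A|$. The diameter of a finite set is $\max A-\min A$. A set $A\subset[a,b]$ is called $P_n$ if $[2a+n,2b-n]\subset A+A$ and $[-(b-a)+n,(b-a)-n]\subset A-A$; here $A\subset[1,2n]$, so $a=1$, $b=2n$. -}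

module Defs where

open import Data.Nat as ℕ using (ℕ; zero; suc; _%_; _/_)
open import Data.Integer using (ℤ; +_; _+_; _-_; _*_; _≤_; _<_; _≤?_; _⊔_; _⊓_; _≟_)
open import Data.List using (List; []; _∷_; map; concatMap; filter; length; deduplicate; upTo; foldr; _++_)
open import Data.List.Membership.Propositional using (_∈_)
open import Relation.Nullary using (yes; no; ¬?)
open import Data.Product using (_×_)

-- Finite sets of integers are represented by lists (duplicates allowed;
-- cardinality counts distinct elements).

_⊆ˢ_ : List ℤ → List ℤ → Set
A ⊆ˢ B = ∀ x → x ∈ A → x ∈ B

card : List ℤ → ℕ
card A = length (deduplicate _≟_ A)

_⊕_ : List ℤ → List ℤ → List ℤ
A ⊕ B = concatMap (λ a → map (λ b → a + b) B) A

_⊖_ : List ℤ → List ℤ → List ℤ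
A ⊖ B = concatMap (λ a → map (λ b → a - b) B) A

shift : List ℤ → ℤ → List ℤ
shift A t = map (λ a → a + t) A

interval : ℤ → ℤ → List ℤ
interval x y with x ≤? y
... | yes _ = map (λ i → x + + i) (upTo (suc (Data.Integer.∣ y - x ∣)))
... | no _ = []

remove : ℤ → List ℤ → List ℤ
remove t A = filter (λ z → ¬? (z ≟ t)) A

MSTD : List ℤ → Set
MSTD A = card (A ⊖ A) ℕ.< card (A ⊕ A)

MDTS : List ℤ → Set
MDTS A = card (A ⊕ A) ℕ.< card (A ⊖ A)

diam : List ℤ → ℤ
diam [] = + 0
diam (x ∷ xs) = foldr _⊔_ x xs - foldr _⊓_ x xs

IsP : ℕ → ℤ → ℤ → List ℤ → Set
IsP n a b A =
  (interval (+ 2 * a + + n) (+ 2 * b - + n) ⊆ˢ (A ⊕ A)) ×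
  (interval (Data.Integer.- (b - a) + + n) ((b - a) - + n) ⊆ˢ (A ⊖ A))

middle : ℕ → ℕ → List ℤ
middle n l = remove (+ n) (interval ((+ 1 - + l) * + n) ((+ l + + 1) * + n))

Aeven : ℕ → ℕ → List ℤ
Aeven n l = middle n l ++ ((+ l + + 2) * + n ∷ [])

Aodd : ℕ → List ℤ → List ℤ → ℕ → List ℤ
Aodd n L R l = shift L (Data.Integer.- (+ l * + n) - + 1) ++ middle n l ++ shift R (+ l * + n)

seqA : ℕ → List ℤ → List ℤ → ℕ → List ℤ
seqA n L R m with m % 2 | m / 2
... | zero | l = Aeven n l
... | suc _ | zero = L ++ R
... | suc _ | suc l = Aodd n L R (suc l)

module Submission where

-- Write N = n (≥ 2, as 1 ∈ A and n ∉ A) and Λ = l, and let M = [(1 - Λ)N, (Λ + 1)N] ∖ {N},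
-- so that A₂ₗ = M ∪ {(Λ + 2)N}. Then A₂ₗ - A₂ₗ is the whole interval [-(2Λ + 1)N, (2Λ + 1)N],
-- while A₂ₗ + A₂ₗ lies in [(2 - 2Λ)N, (2Λ + 3)N] ∪ {(2Λ + 4)N}; as N ≥ 2, A₂ₗ is MDTS.
-- A₂ₗ₊₁ = (L - ΛN - 1) ∪ M ∪ (R + ΛN) contains A₂ₗ, so its sumset and difference set
-- contain the full blocks [(1 - 2Λ)N, (2Λ + 3)N] and [-(2Λ + 1)N, (2Λ + 1)N], both with
-- (4Λ + 2)N + 1 elements. Outside them only the outer parts contribute: translates of
-- L + L and R + R at the ends of the sumset, of L - R and R - L at the ends of the
-- difference set. The same holds for A with the blocks [n + 2, 3n] and [1 - n, n - 1]
-- given by the P_n property, both with 2n - 1 elements. Hence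
-- |A₂ₗ₊₁ + A₂ₗ₊₁| - |A₂ₗ₊₁ - A₂ₗ₊₁| = |A + A| - |A - A| > 0. Inclusions and diameters are
-- read off from the extreme elements.

module FiniteSets where

  open import Defs
  open import Data.Integer as ℤ using (ℤ; +_; _+_; _-_; _*_; -_; _≤_; _<_; ∣_∣; 0ℤ; +≤+; _⊔_; _⊓_)
  import Data.Integer.Properties as ℤP
  open import Algebra.Properties.AbelianGroup ℤP.+-0-abelianGroup using (∙-cancelˡ; ∙-cancelʳ)
  open import Data.Integer.Tactic.RingSolver using (solve; solve-∀)
  open import Data.Nat as ℕ using (ℕ; suc; z≤n; s≤s)
  import Data.Nat.Properties as ℕP
  open import Data.List using (List; []; _∷_; _++_; map; filter; length; deduplicate; foldr; upTo; cartesianProductWith)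
  open import Data.List.Properties using (length-++; length-map; length-upTo; filter-++; filter-all; length-filter; foldr-preservesᵇ; foldr-preservesᵒ)
  open import Data.List.Membership.Propositional using (_∈_)
  open import Data.List.Membership.Propositional.Properties
    using (∈-++⁺ˡ; ∈-++⁺ʳ; ∈-++⁻; ∈-map⁺; ∈-map⁻; ∈-filter⁺; ∈-filter⁻; ∈-upTo⁺; ∈-upTo⁻; ∈-cartesianProductWith⁺; ∈-cartesianProductWith⁻; ∈-deduplicate⁺; ∈-deduplicate⁻)
  open import Data.List.Membership.DecPropositional ℤ._≟_ using (_∈?_)
  open import Data.List.Membership.Propositional.Properties.WithK using (unique∧set⇒bag)
  open import Data.List.Relation.Unary.Any as Any using (here; there)
  open import Data.List.Relation.Unary.All as All using (All)
  open import Data.List.Relation.Unary.AllPairs using ([]; _∷_)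
  open import Data.List.Relation.Unary.Unique.Propositional using (Unique)
  import Data.List.Relation.Unary.Unique.Propositional.Properties as Unique
  open import Data.List.Relation.Unary.Unique.DecPropositional.Properties ℤ._≟_ using (deduplicate-!)
  open import Data.List.Relation.Binary.BagAndSetEquality using (∼bag⇒↭)
  open import Data.List.Relation.Binary.Permutation.Propositional using (_↭_)
  open import Data.List.Relation.Binary.Permutation.Propositional.Properties using (↭-length; filter-↭)
  open import Data.Product using (∃₂; _×_; _,_; proj₁; proj₂)
  open import Data.Sum using (_⊎_; inj₁; inj₂; [_,_])
  open import Data.Empty using (⊥; ⊥-elim)
  open import Function using (_∘_; _⇔_; mk⇔; Equivalence)
  open import Relation.Binary.PropositionalEquality using (_≡_; _≢_; refl; sym; trans; cong; cong₂; subst; subst₂; module ≡-Reasoning)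
  open import Relation.Nullary using (yes; no; ¬?)

  private
    variable
      a b c d e m M x lo hi : ℤ
      X Y Lo Hi S T : List ℤ

  -- Linear inequalities are proved by certificates: for a ≤ b, b - a is written as a
  -- sum of terms known to be nonnegative and the ring solver checks the identity.

  infixr 5 _⊞_

  _⊞_ : 0ℤ ≤ a → 0ℤ ≤ b → 0ℤ ≤ a + b
  _⊞_ = ℤP.+-mono-≤

  0≤+ : ∀ n → 0ℤ ≤ + n
  0≤+ n = +≤+ z≤n

  *-nonNeg : 0ℤ ≤ a → 0ℤ ≤ b → 0ℤ ≤ a * b
  *-nonNeg (+≤+ {n = i} _) (+≤+ {n = j} _) = subst (0ℤ ≤_) (ℤP.pos-* i j) (0≤+ (i ℕ.* j))

  ≤⇒0≤ : a ≤ b → 0ℤ ≤ b - a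
  ≤⇒0≤ = ℤP.i≤j⇒0≤j-i

  <⇒0≤ : a < b → 0ℤ ≤ b - (+ 1 + a)
  <⇒0≤ = ℤP.i≤j⇒0≤j-i ∘ ℤP.i<j⇒suc[i]≤j

  ≤-by : 0ℤ ≤ e → b - a ≡ e → a ≤ b
  ≤-by 0≤e refl = ℤP.0≤i-j⇒j≤i 0≤e

  <-by : 0ℤ ≤ e → b - (+ 1 + a) ≡ e → a < b
  <-by 0≤e eq = ℤP.suc[i]≤j⇒i<j (≤-by 0≤e eq)

  1+[i-1]≡i : ∀ i → + 1 + (i - + 1) ≡ i
  1+[i-1]≡i = solve-∀

  -[i-j]≡j-i : ∀ i j → - (i - j) ≡ j - i
  -[i-j]≡j-i = solve-∀

  <-transfer : ∀ {s d s′ d′} → s′ - d′ ≡ s - d → d < s → d′ < s′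
  <-transfer {s} {d} {s′} {d′} eq d<s = <-by (<⇒0≤ d<s) (begin
    s′ - (+ 1 + d′) ≡⟨ regroup s′ d′ ⟩
    (s′ - d′) - + 1 ≡⟨ cong (_- + 1) eq ⟩
    (s - d) - + 1   ≡⟨ regroup s d ⟨
    s - (+ 1 + d)   ∎)
    where
    open ≡-Reasoning
    regroup : ∀ s d → s - (+ 1 + d) ≡ (s - d) - + 1
    regroup = solve-∀

  ⊕≡cartesianProductWith : ∀ X Y → X ⊕ Y ≡ cartesianProductWith _+_ X Y
  ⊕≡cartesianProductWith []      Y = refl
  ⊕≡cartesianProductWith (a ∷ X) Y = cong (map (λ b → a + b) Y ++_) (⊕≡cartesianProductWith X Y)

  ⊖≡cartesianProductWith : ∀ X Y → X ⊖ Y ≡ cartesianProductWith _-_ X Y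
  ⊖≡cartesianProductWith []      Y = refl
  ⊖≡cartesianProductWith (a ∷ X) Y = cong (map (λ b → a - b) Y ++_) (⊖≡cartesianProductWith X Y)

  ∈-⊕⁺ : a ∈ X → b ∈ Y → x ≡ a + b → x ∈ X ⊕ Y
  ∈-⊕⁺ {X = X} {Y = Y} a∈X b∈Y refl =
    subst (_ ∈_) (sym (⊕≡cartesianProductWith X Y)) (∈-cartesianProductWith⁺ _+_ a∈X b∈Y)

  ∈-⊕⁻ : ∀ X Y → x ∈ X ⊕ Y → ∃₂ λ a b → a ∈ X × b ∈ Y × x ≡ a + b
  ∈-⊕⁻ X Y x∈ = ∈-cartesianProductWith⁻ _+_ X Y (subst (_ ∈_) (⊕≡cartesianProductWith X Y) x∈)

  ∈-⊖⁺ : a ∈ X → b ∈ Y → x ≡ a - b → x ∈ X ⊖ Y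
  ∈-⊖⁺ {X = X} {Y = Y} a∈X b∈Y refl =
    subst (_ ∈_) (sym (⊖≡cartesianProductWith X Y)) (∈-cartesianProductWith⁺ _-_ a∈X b∈Y)

  ∈-⊖⁻ : ∀ X Y → x ∈ X ⊖ Y → ∃₂ λ a b → a ∈ X × b ∈ Y × x ≡ a - b
  ∈-⊖⁻ X Y x∈ = ∈-cartesianProductWith⁻ _-_ X Y (subst (_ ∈_) (⊖≡cartesianProductWith X Y) x∈)

  ⊕-mono : X ⊆ˢ S → Y ⊆ˢ T → (X ⊕ Y) ⊆ˢ (S ⊕ T)
  ⊕-mono {X} {Y = Y} X⊆S Y⊆T x x∈ with ∈-⊕⁻ X Y x∈
  ... | a , b , a∈ , b∈ , x≡ = ∈-⊕⁺ (X⊆S a a∈) (Y⊆T b b∈) x≡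

  ⊖-mono : X ⊆ˢ S → Y ⊆ˢ T → (X ⊖ Y) ⊆ˢ (S ⊖ T)
  ⊖-mono {X} {Y = Y} X⊆S Y⊆T x x∈ with ∈-⊖⁻ X Y x∈
  ... | a , b , a∈ , b∈ , x≡ = ∈-⊖⁺ (X⊆S a a∈) (Y⊆T b b∈) x≡

  ⊖-neg : ∀ X Y → x ∈ X ⊖ Y → - x ∈ Y ⊖ X
  ⊖-neg X Y x∈ with ∈-⊖⁻ X Y x∈
  ... | a , b , a∈ , b∈ , refl = ∈-⊖⁺ b∈ a∈ (-[i-j]≡j-i a b)

  ⊕-bounds : (∀ {a} → a ∈ X → m ≤ a × a ≤ M) → x ∈ X ⊕ X → m + m ≤ x × x ≤ M + M
  ⊕-bounds {X} bounds x∈ with ∈-⊕⁻ X X x∈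
  ... | a , b , a∈ , b∈ , refl =
    ℤP.+-mono-≤ (proj₁ (bounds a∈)) (proj₁ (bounds b∈)) , ℤP.+-mono-≤ (proj₂ (bounds a∈)) (proj₂ (bounds b∈))

  ⊖-bounds : (∀ {a} → a ∈ X → m ≤ a × a ≤ M) → x ∈ X ⊖ X → m - M ≤ x × x ≤ M - m
  ⊖-bounds {X} bounds x∈ with ∈-⊖⁻ X X x∈
  ... | a , b , a∈ , b∈ , refl =
    ℤP.+-mono-≤ (proj₁ (bounds a∈)) (ℤP.neg-mono-≤ (proj₂ (bounds b∈))) ,
    ℤP.+-mono-≤ (proj₂ (bounds a∈)) (ℤP.neg-mono-≤ (proj₁ (bounds b∈)))

  ∈-shift⁺ : a ∈ X → x ≡ a + e → x ∈ shift X e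
  ∈-shift⁺ {e = e} a∈ refl = ∈-map⁺ (_+ e) a∈

  ∈-shift⊕shift : ∀ X d Y e → x ∈ shift X d ⊕ shift Y e ⇔ x - (d + e) ∈ X ⊕ Y
  ∈-shift⊕shift {x} X d Y e = mk⇔ to from
    where
    to : x ∈ shift X d ⊕ shift Y e → x - (d + e) ∈ X ⊕ Y
    to x∈ with ∈-⊕⁻ (shift X d) (shift Y e) x∈
    ... | _ , _ , a∈ , b∈ , refl with ∈-map⁻ (_+ d) a∈ | ∈-map⁻ (_+ e) b∈
    ... | a , a∈X , refl | b , b∈Y , refl = ∈-⊕⁺ a∈X b∈Y (shifts-cancel a b)
      where
      shifts-cancel : ∀ a b → a + d + (b + e) - (d + e) ≡ a + b
      shifts-cancel a b = solve (a ∷ b ∷ d ∷ e ∷ [])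
    from : x - (d + e) ∈ X ⊕ Y → x ∈ shift X d ⊕ shift Y e
    from x∈ with ∈-⊕⁻ X Y x∈
    ... | a , b , a∈X , b∈Y , x≡ = ∈-⊕⁺ (∈-shift⁺ a∈X refl) (∈-shift⁺ b∈Y refl) (begin
      x                     ≡⟨ solve (x ∷ d ∷ e ∷ []) ⟩
      x - (d + e) + (d + e) ≡⟨ cong (_+ (d + e)) x≡ ⟩
      a + b + (d + e)       ≡⟨ solve (a ∷ b ∷ d ∷ e ∷ []) ⟩
      a + d + (b + e)       ∎)
      where open ≡-Reasoning

  ∈-shift⊖shift : ∀ X d Y e → x ∈ shift X d ⊖ shift Y e ⇔ x - (d - e) ∈ X ⊖ Y
  ∈-shift⊖shift {x} X d Y e = mk⇔ to from
    where
    to : x ∈ shift X d ⊖ shift Y e → x - (d - e) ∈ X ⊖ Y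
    to x∈ with ∈-⊖⁻ (shift X d) (shift Y e) x∈
    ... | _ , _ , a∈ , b∈ , refl with ∈-map⁻ (_+ d) a∈ | ∈-map⁻ (_+ e) b∈
    ... | a , a∈X , refl | b , b∈Y , refl = ∈-⊖⁺ a∈X b∈Y (shifts-cancel a b)
      where
      shifts-cancel : ∀ a b → a + d - (b + e) - (d - e) ≡ a - b
      shifts-cancel a b = solve (a ∷ b ∷ d ∷ e ∷ [])
    from : x - (d - e) ∈ X ⊖ Y → x ∈ shift X d ⊖ shift Y e
    from x∈ with ∈-⊖⁻ X Y x∈
    ... | a , b , a∈X , b∈Y , x≡ = ∈-⊖⁺ (∈-shift⁺ a∈X refl) (∈-shift⁺ b∈Y refl) (begin
      x                     ≡⟨ solve (x ∷ d ∷ e ∷ []) ⟩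
      x - (d - e) + (d - e) ≡⟨ cong (_+ (d - e)) x≡ ⟩
      a - b + (d - e)       ≡⟨ solve (a ∷ b ∷ d ∷ e ∷ []) ⟩
      (a + d) - (b + e)     ∎)
      where open ≡-Reasoning

  -- Near the ends of X ± X only the elements of Lo and Hi take part.
  record Ends (X Lo Hi : List ℤ) (m c d M : ℤ) : Set where
    field
      bounds  : a ∈ X → m ≤ a × a ≤ M
      Lo⊆     : Lo ⊆ˢ X
      Hi⊆     : Hi ⊆ˢ X
      Lo-or-≥ : a ∈ X → a ∈ Lo ⊎ c ≤ a
      Hi-or-≤ : a ∈ X → a ∈ Hi ⊎ a ≤ d

  module _ (ends : Ends X Lo Hi m c d M) where
    open Ends ends

    ⊕-low : x < c + m → x ∈ X ⊕ X ⇔ x ∈ Lo ⊕ Lo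
    ⊕-low {x} x<c+m = mk⇔ to (⊕-mono Lo⊆ Lo⊆ x)
      where
      to : x ∈ X ⊕ X → x ∈ Lo ⊕ Lo
      to x∈ with ∈-⊕⁻ X X x∈
      ... | a , b , a∈ , b∈ , refl with Lo-or-≥ a∈ | Lo-or-≥ b∈
      ... | inj₁ a∈Lo | inj₁ b∈Lo = ∈-⊕⁺ a∈Lo b∈Lo refl
      ... | inj₂ c≤a  | _         = ⊥-elim (ℤP.<⇒≱ x<c+m (ℤP.+-mono-≤ c≤a (proj₁ (bounds b∈))))
      ... | inj₁ _    | inj₂ c≤b  =
        ⊥-elim (ℤP.<⇒≱ x<c+m (subst (_ ≤_) (ℤP.+-comm b a) (ℤP.+-mono-≤ c≤b (proj₁ (bounds a∈)))))

    ⊕-high : d + M < x → x ∈ X ⊕ X ⇔ x ∈ Hi ⊕ Hi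
    ⊕-high {x} d+M<x = mk⇔ to (⊕-mono Hi⊆ Hi⊆ x)
      where
      to : x ∈ X ⊕ X → x ∈ Hi ⊕ Hi
      to x∈ with ∈-⊕⁻ X X x∈
      ... | a , b , a∈ , b∈ , refl with Hi-or-≤ a∈ | Hi-or-≤ b∈
      ... | inj₁ a∈Hi | inj₁ b∈Hi = ∈-⊕⁺ a∈Hi b∈Hi refl
      ... | inj₂ a≤d  | _         = ⊥-elim (ℤP.<⇒≱ d+M<x (ℤP.+-mono-≤ a≤d (proj₂ (bounds b∈))))
      ... | inj₁ _    | inj₂ b≤d  =
        ⊥-elim (ℤP.<⇒≱ d+M<x (subst (_≤ _) (ℤP.+-comm b a) (ℤP.+-mono-≤ b≤d (proj₂ (bounds a∈)))))

    ⊖-low : x < c - M → x < m - d → x ∈ X ⊖ X ⇔ x ∈ Lo ⊖ Hi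
    ⊖-low {x} x<c-M x<m-d = mk⇔ to (⊖-mono Lo⊆ Hi⊆ x)
      where
      to : x ∈ X ⊖ X → x ∈ Lo ⊖ Hi
      to x∈ with ∈-⊖⁻ X X x∈
      ... | a , b , a∈ , b∈ , refl with Lo-or-≥ a∈ | Hi-or-≤ b∈
      ... | inj₁ a∈Lo | inj₁ b∈Hi = ∈-⊖⁺ a∈Lo b∈Hi refl
      ... | inj₂ c≤a  | _         =
        ⊥-elim (ℤP.<⇒≱ x<c-M (ℤP.+-mono-≤ c≤a (ℤP.neg-mono-≤ (proj₂ (bounds b∈)))))
      ... | inj₁ _    | inj₂ b≤d  =
        ⊥-elim (ℤP.<⇒≱ x<m-d (ℤP.+-mono-≤ (proj₁ (bounds a∈)) (ℤP.neg-mono-≤ b≤d)))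

    ⊖-high : d - m < x → M - c < x → x ∈ X ⊖ X ⇔ x ∈ Hi ⊖ Lo
    ⊖-high {x} d-m<x M-c<x = mk⇔ to (⊖-mono Hi⊆ Lo⊆ x)
      where
      to : x ∈ X ⊖ X → x ∈ Hi ⊖ Lo
      to x∈ with ∈-⊖⁻ X X x∈
      ... | a , b , a∈ , b∈ , refl with Hi-or-≤ a∈ | Lo-or-≥ b∈
      ... | inj₁ a∈Hi | inj₁ b∈Lo = ∈-⊖⁺ a∈Hi b∈Lo refl
      ... | inj₂ a≤d  | _         =
        ⊥-elim (ℤP.<⇒≱ d-m<x (ℤP.+-mono-≤ a≤d (ℤP.neg-mono-≤ (proj₁ (bounds b∈)))))
      ... | inj₁ _    | inj₂ c≤b  =
        ⊥-elim (ℤP.<⇒≱ M-c<x (ℤP.+-mono-≤ (proj₂ (bounds a∈)) (ℤP.neg-mono-≤ c≤b)))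

  ∈-remove⁺ : x ∈ X → x ≢ e → x ∈ remove e X
  ∈-remove⁺ {e = e} = ∈-filter⁺ (λ z → ¬? (z ℤ.≟ e))

  ∈-remove⁻ : ∀ X → x ∈ remove e X → x ∈ X × x ≢ e
  ∈-remove⁻ {e = e} X = ∈-filter⁻ (λ z → ¬? (z ℤ.≟ e)) {xs = X}

  ∈-interval⁻ : ∀ lo hi → x ∈ interval lo hi → lo ≤ x × x ≤ hi
  ∈-interval⁻ lo hi x∈ with lo ℤ.≤? hi
  ∈-interval⁻ lo hi () | no _
  ... | yes lo≤hi with ∈-map⁻ (λ i → lo + + i) x∈
  ...   | i , i∈ , refl = ≤-by (+≤+ z≤n) (add-sub lo (+ i)) , ≤-by (≤⇒0≤ i≤hi-lo) (sub-add lo hi (+ i))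
    where
    add-sub : ∀ a j → a + j - a ≡ j
    add-sub = solve-∀
    sub-add : ∀ a b j → b - (a + j) ≡ b - a - j
    sub-add = solve-∀
    i≤hi-lo : + i ≤ hi - lo
    i≤hi-lo = subst (+ i ≤_) (ℤP.0≤i⇒+∣i∣≡i (≤⇒0≤ lo≤hi)) (+≤+ (ℕP.≤-pred (∈-upTo⁻ i∈)))

  ∈-interval⁺ : ∀ lo hi → lo ≤ x → x ≤ hi → x ∈ interval lo hi
  ∈-interval⁺ {x} lo hi lo≤x x≤hi with lo ℤ.≤? hi
  ... | no lo≰hi = ⊥-elim (lo≰hi (ℤP.≤-trans lo≤x x≤hi))
  ... | yes lo≤hi = subst (_∈ _) (trans (cong (λ t → lo + t) offset≡) (add-sub lo x))
                      (∈-map⁺ (λ i → lo + + i) (∈-upTo⁺ (s≤s (ℤP.drop‿+≤+ offset≤))))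
    where
    offset≡ : + ∣ x - lo ∣ ≡ x - lo
    offset≡ = ℤP.0≤i⇒+∣i∣≡i (≤⇒0≤ lo≤x)
    offset≤ : + ∣ x - lo ∣ ≤ + ∣ hi - lo ∣
    offset≤ = subst₂ _≤_ (sym offset≡) (sym (ℤP.0≤i⇒+∣i∣≡i (≤⇒0≤ lo≤hi))) (ℤP.+-monoˡ-≤ (- lo) x≤hi)
    add-sub : ∀ a b → a + (b - a) ≡ b
    add-sub = solve-∀

  interval-unique : ∀ lo hi → Unique (interval lo hi)
  interval-unique lo hi with lo ℤ.≤? hi
  ... | no _  = []
  ... | yes _ = Unique.map⁺ (ℤP.+-injective ∘ ∙-cancelˡ lo _ _) (Unique.upTo⁺ _)

  length-interval : lo ≤ + 1 + hi → + length (interval lo hi) ≡ hi - lo + + 1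
  length-interval {lo} {hi} lo≤1+hi with lo ℤ.≤? hi
  ... | yes lo≤hi = begin
    + length (map (λ i → lo + + i) (upTo (suc ∣ hi - lo ∣)))
      ≡⟨ cong +_ (trans (length-map (λ i → lo + + i) (upTo (suc ∣ hi - lo ∣))) (length-upTo (suc ∣ hi - lo ∣))) ⟩
    + 1 + + ∣ hi - lo ∣
      ≡⟨ cong (λ t → + 1 + t) (ℤP.0≤i⇒+∣i∣≡i (≤⇒0≤ lo≤hi)) ⟩
    + 1 + (hi - lo)
      ≡⟨ solve (lo ∷ hi ∷ []) ⟩
    hi - lo + + 1 ∎
    where open ≡-Reasoning
  ... | no lo≰hi = sym (empty (ℤP.≤-antisym lo≤1+hi (ℤP.i<j⇒suc[i]≤j (ℤP.≰⇒> lo≰hi))))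
    where
    empty : lo ≡ + 1 + hi → hi - lo + + 1 ≡ 0ℤ
    empty refl = solve (hi ∷ [])

  ↭-by-∈ : ∀ {I J : List ℤ} → Unique I → Unique J → (∀ {x} → x ∈ I ⇔ x ∈ J) → I ↭ J
  ↭-by-∈ uI uJ I≈J = ∼bag⇒↭ (unique∧set⇒bag uI uJ I≈J)

  interval-split : ∀ lo m hi → lo ≤ + 1 + m → m ≤ hi → interval lo hi ↭ interval lo m ++ interval (+ 1 + m) hi
  interval-split lo m hi lo≤1+m m≤hi =
    ↭-by-∈ (interval-unique lo hi)
           (Unique.++⁺ (interval-unique lo m) (interval-unique (+ 1 + m) hi) disjoint)
           (mk⇔ to from)
    where
    disjoint : ∀ {x} → x ∈ interval lo m × x ∈ interval (+ 1 + m) hi → ⊥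
    disjoint (x∈ˡ , x∈ʳ) = ℤP.<⇒≱ (ℤP.suc[i]≤j⇒i<j (proj₁ (∈-interval⁻ _ hi x∈ʳ))) (proj₂ (∈-interval⁻ lo m x∈ˡ))
    to : x ∈ interval lo hi → x ∈ interval lo m ++ interval (+ 1 + m) hi
    to {x} x∈ with ∈-interval⁻ lo hi x∈ | x ℤ.≤? m
    ... | lo≤x , _    | yes x≤m = ∈-++⁺ˡ (∈-interval⁺ lo m lo≤x x≤m)
    ... | _    , x≤hi | no x≰m  = ∈-++⁺ʳ _ (∈-interval⁺ (+ 1 + m) hi (ℤP.i<j⇒suc[i]≤j (ℤP.≰⇒> x≰m)) x≤hi)
    from : x ∈ interval lo m ++ interval (+ 1 + m) hi → x ∈ interval lo hi
    from x∈ with ∈-++⁻ (interval lo m) x∈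
    ... | inj₁ x∈ˡ = let lo≤x , x≤m = ∈-interval⁻ lo m x∈ˡ in
                     ∈-interval⁺ lo hi lo≤x (ℤP.≤-trans x≤m m≤hi)
    ... | inj₂ x∈ʳ = let 1+m≤x , x≤hi = ∈-interval⁻ (+ 1 + m) hi x∈ʳ in
                     ∈-interval⁺ lo hi (ℤP.≤-trans lo≤1+m 1+m≤x) x≤hi

  interval-shift : ∀ lo hi d → map (_+ d) (interval lo hi) ↭ interval (lo + d) (hi + d)
  interval-shift lo hi d =
    ↭-by-∈ (Unique.map⁺ (∙-cancelʳ d _ _) (interval-unique lo hi)) (interval-unique (lo + d) (hi + d)) (mk⇔ to from)
    where
    to : x ∈ map (_+ d) (interval lo hi) → x ∈ interval (lo + d) (hi + d)
    to x∈ with ∈-map⁻ (_+ d) x∈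
    ... | y , y∈ , refl = let lo≤y , y≤hi = ∈-interval⁻ lo hi y∈ in
                          ∈-interval⁺ _ _ (ℤP.+-monoˡ-≤ d lo≤y) (ℤP.+-monoˡ-≤ d y≤hi)
    from : x ∈ interval (lo + d) (hi + d) → x ∈ map (_+ d) (interval lo hi)
    from {x} x∈ = let lo+d≤x , x≤hi+d = ∈-interval⁻ _ _ x∈ in
      subst (_∈ _) (sub-add x d)
        (∈-map⁺ (_+ d) (∈-interval⁺ lo hi (≤-by (≤⇒0≤ lo+d≤x) (shuffle x lo d))
                                          (≤-by (≤⇒0≤ x≤hi+d) (shuffle′ x hi d))))
      where
      sub-add : ∀ x d → x - d + d ≡ x
      sub-add = solve-∀
      shuffle : ∀ x lo d → x - d - lo ≡ x - (lo + d)
      shuffle = solve-∀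
      shuffle′ : ∀ x hi d → hi - (x - d) ≡ hi + d - x
      shuffle′ = solve-∀

  count : List ℤ → List ℤ → ℕ
  count S I = length (filter (_∈? S) I)

  count-↭ : ∀ {I J} → I ↭ J → count S I ≡ count S J
  count-↭ I↭J = ↭-length (filter-↭ _ I↭J)

  count-++ : ∀ I J → count S (I ++ J) ≡ count S I ℕ.+ count S J
  count-++ {S} I J = trans (cong length (filter-++ (_∈? S) I J)) (length-++ (filter (_∈? S) I))

  count-full : ∀ {I} → (∀ {x} → x ∈ I → x ∈ S) → count S I ≡ length I
  count-full {S} I⊆S = cong length (filter-all (_∈? S) (All.tabulate I⊆S))

  count≤length : ∀ I → count S I ℕ.≤ length I
  count≤length {S} = length-filter (_∈? S)

  count-map : ∀ (f : ℤ → ℤ) I → (∀ {x} → x ∈ I → (x ∈ S ⇔ f x ∈ T)) → count T (map f I) ≡ count S I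
  count-map f [] _ = refl
  count-map {S} {T} f (x ∷ I) x∈S⇔ with x ∈? S | f x ∈? T
  ... | yes _   | yes _   = cong suc (count-map f I (x∈S⇔ ∘ there))
  ... | no _    | no _    = count-map f I (x∈S⇔ ∘ there)
  ... | yes x∈S | no fx∉T = ⊥-elim (fx∉T (Equivalence.to (x∈S⇔ (here refl)) x∈S))
  ... | no x∉S  | yes fx∈T = ⊥-elim (x∉S (Equivalence.from (x∈S⇔ (here refl)) fx∈T))

  card≡count : ∀ {I} → Unique I → S ⊆ˢ I → card S ≡ count S I
  card≡count {S} {I} uI S⊆I =
    ↭-length (↭-by-∈ (deduplicate-! S) (Unique.filter⁺ (_∈? S) uI) (mk⇔ to from))
    where
    to : x ∈ deduplicate ℤ._≟_ S → x ∈ filter (_∈? S) I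
    to x∈ = let x∈S = ∈-deduplicate⁻ ℤ._≟_ S x∈ in ∈-filter⁺ (_∈? S) (S⊆I _ x∈S) x∈S
    from : x ∈ filter (_∈? S) I → x ∈ deduplicate ℤ._≟_ S
    from x∈ = ∈-deduplicate⁺ ℤ._≟_ (proj₂ (∈-filter⁻ (_∈? S) {xs = I} x∈))

  bounded⇒⊆interval : (∀ {x} → x ∈ S → lo ≤ x × x ≤ hi) → S ⊆ˢ interval lo hi
  bounded⇒⊆interval {lo = lo} {hi} bounds x x∈ =
    let lo≤x , x≤hi = bounds x∈ in ∈-interval⁺ lo hi lo≤x x≤hi

  count-interval-shift : ∀ lo hi d lo′ hi′ → lo + d ≡ lo′ → hi + d ≡ hi′ →
                         (∀ {x} → lo ≤ x → x ≤ hi → (x ∈ S ⇔ x + d ∈ T)) →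
                         count S (interval lo hi) ≡ count T (interval lo′ hi′)
  count-interval-shift lo hi d _ _ refl refl x∈S⇔ =
    trans (sym (count-map (_+ d) (interval lo hi) (λ x∈ → let lo≤x , x≤hi = ∈-interval⁻ lo hi x∈ in x∈S⇔ lo≤x x≤hi)))
          (count-↭ (interval-shift lo hi d))

  card-interval : ∀ lo hi → lo ≤ + 1 + hi → (∀ {x} → x ∈ S → lo ≤ x × x ≤ hi) → interval lo hi ⊆ˢ S →
                  + card S ≡ hi - lo + + 1
  card-interval {S} lo hi lo≤1+hi bounds ⊆S = begin
    + card S                         ≡⟨ cong +_ (card≡count (interval-unique lo hi) (bounded⇒⊆interval bounds)) ⟩
    + count S (interval lo hi)       ≡⟨ cong +_ (count-full (⊆S _)) ⟩
    + length (interval lo hi)        ≡⟨ length-interval lo≤1+hi ⟩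
    hi - lo + + 1                    ∎
    where open ≡-Reasoning

  card-by-blocks : ∀ lo b c hi → lo ≤ b → b ≤ + 1 + c → c ≤ hi →
                   (∀ {x} → x ∈ S → lo ≤ x × x ≤ hi) → interval b c ⊆ˢ S →
                   + card S ≡ + count S (interval lo (b - + 1)) + (c - b + + 1) + + count S (interval (+ 1 + c) hi)
  card-by-blocks {S} lo b c hi lo≤b b≤1+c c≤hi bounds block⊆S = begin
    + card S
      ≡⟨ cong +_ (card≡count (interval-unique lo hi) (bounded⇒⊆interval bounds)) ⟩
    + count S (interval lo hi)
      ≡⟨ cong +_ (count-↭ (interval-split lo (b - + 1) hi lo≤1+[b-1] b-1≤hi)) ⟩
    + count S (interval lo (b - + 1) ++ interval (+ 1 + (b - + 1)) hi)
      ≡⟨ cong (λ l → + count S (interval lo (b - + 1) ++ interval l hi)) (1+[i-1]≡i b) ⟩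
    + count S (interval lo (b - + 1) ++ interval b hi)
      ≡⟨ cong +_ (count-++ (interval lo (b - + 1)) _) ⟩
    + (left ℕ.+ count S (interval b hi))
      ≡⟨ cong (λ k → + (left ℕ.+ k)) (count-↭ (interval-split b c hi b≤1+c c≤hi)) ⟩
    + (left ℕ.+ count S (interval b c ++ interval (+ 1 + c) hi))
      ≡⟨ cong (λ k → + (left ℕ.+ k)) (count-++ (interval b c) _) ⟩
    + (left ℕ.+ (count S (interval b c) ℕ.+ right))
      ≡⟨ cong (λ k → + (left ℕ.+ (k ℕ.+ right))) (count-full (block⊆S _)) ⟩
    + (left ℕ.+ (length (interval b c) ℕ.+ right))
      ≡⟨ trans (ℤP.pos-+ left _) (cong (λ k → + left + k) (ℤP.pos-+ (length (interval b c)) right)) ⟩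
    + left + (+ length (interval b c) + + right)
      ≡⟨ cong (λ k → + left + (k + + right)) (length-interval b≤1+c) ⟩
    + left + (c - b + + 1 + + right)
      ≡⟨ ℤP.+-assoc (+ left) (c - b + + 1) (+ right) ⟨
    + left + (c - b + + 1) + + right ∎
    where
    open ≡-Reasoning
    left = count S (interval lo (b - + 1))
    right = count S (interval (+ 1 + c) hi)
    lo≤1+[b-1] : lo ≤ + 1 + (b - + 1)
    lo≤1+[b-1] = subst (lo ≤_) (sym (1+[i-1]≡i b)) lo≤b
    b-1≤hi : b - + 1 ≤ hi
    b-1≤hi = ≤-by (≤⇒0≤ b≤1+c ⊞ ≤⇒0≤ c≤hi) (shuffle b c hi)
      where
      shuffle : ∀ b c hi → hi - (b - + 1) ≡ + 1 + c - b + (hi - c)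
      shuffle = solve-∀

  card≤interval∪point : ∀ lo c h → lo ≤ + 1 + c → c < h → (∀ {x} → x ∈ S → (lo ≤ x × x ≤ c) ⊎ x ≡ h) →
                        + card S ≤ c - lo + + 2
  card≤interval∪point {S} lo c h lo≤1+c c<h bounds = begin
    + card S                                    ≡⟨ cong +_ (card≡count unique S⊆) ⟩
    + count S (interval lo c ++ h ∷ [])         ≤⟨ +≤+ (count≤length (interval lo c ++ h ∷ [])) ⟩
    + length (interval lo c ++ h ∷ [])          ≡⟨ cong +_ (length-++ (interval lo c)) ⟩
    + length (interval lo c) + + 1              ≡⟨ cong (_+ + 1) (length-interval lo≤1+c) ⟩
    c - lo + + 1 + + 1                          ≡⟨ solve (lo ∷ c ∷ []) ⟩
    c - lo + + 2                                ∎
    where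
    open ℤP.≤-Reasoning
    S⊆ : S ⊆ˢ (interval lo c ++ h ∷ [])
    S⊆ x x∈ with bounds x∈
    ... | inj₁ (lo≤x , x≤c) = ∈-++⁺ˡ (∈-interval⁺ lo c lo≤x x≤c)
    ... | inj₂ refl         = ∈-++⁺ʳ (interval lo c) (here refl)
    unique : Unique (interval lo c ++ h ∷ [])
    unique = Unique.++⁺ (interval-unique lo c) (All.[] ∷ [])
               (λ { (h∈ , here refl) → ℤP.<⇒≱ c<h (proj₂ (∈-interval⁻ lo c h∈)) })

  diam≡ : ∀ {mn mx} → mn ∈ S → mx ∈ S → (∀ {x} → x ∈ S → mn ≤ x × x ≤ mx) → diam S ≡ mx - mn
  diam≡ {y ∷ ys} {mn} {mx} mn∈ mx∈ bounds = cong₂ _-_ max≡mx min≡mn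
    where
    head-or-tail : ∀ {v} → v ∈ y ∷ ys → v ≤ y ⊎ Any.Any (v ≤_) ys
    head-or-tail (here refl) = inj₁ ℤP.≤-refl
    head-or-tail (there v∈) = inj₂ (Any.map ℤP.≤-reflexive v∈)
    head-or-tail′ : ∀ {v} → v ∈ y ∷ ys → y ≤ v ⊎ Any.Any (_≤ v) ys
    head-or-tail′ (here refl) = inj₁ ℤP.≤-refl
    head-or-tail′ (there v∈) = inj₂ (Any.map (ℤP.≤-reflexive ∘ sym) v∈)
    max≡mx : foldr _⊔_ y ys ≡ mx
    max≡mx = ℤP.≤-antisym
      (foldr-preservesᵇ ℤP.⊔-lub (proj₂ (bounds (here refl))) (All.tabulate (proj₂ ∘ bounds ∘ there)))
      (foldr-preservesᵒ (λ a b → [ ℤP.i≤j⇒i≤j⊔k b , ℤP.i≤j⇒i≤k⊔j a ]) y ys (head-or-tail mx∈))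
    min≡mn : foldr _⊓_ y ys ≡ mn
    min≡mn = ℤP.≤-antisym
      (foldr-preservesᵒ (λ a b → [ ℤP.i≤j⇒i⊓k≤j b , ℤP.i≤j⇒k⊓i≤j a ]) y ys (head-or-tail′ mn∈))
      (foldr-preservesᵇ ℤP.⊓-glb (proj₁ (bounds (here refl))) (All.tabulate (proj₁ ∘ bounds ∘ there)))

module Sequence where

  open import Defs
  open FiniteSets
  open import Data.Integer as ℤ using (ℤ; +_; _+_; _-_; _*_; -_; _≤_; _<_; 0ℤ; +≤+)
  import Data.Integer.Properties as ℤP
  open import Data.Integer.Tactic.RingSolver using (solve; solve-∀)
  open import Data.Nat as ℕ using (ℕ; zero; suc; z≤n; s≤s; _∸_; _%_; _/_)
  import Data.Nat.Properties as ℕP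
  open import Data.Nat.DivMod using (%-remove-+ʳ; +-distrib-/-∣ʳ; m*n/n≡m)
  open import Data.Nat.Divisibility using (m∣m*n)
  open import Data.List using (List; []; _∷_; _++_)
  open import Data.List.Membership.Propositional using (_∈_; _∉_)
  open import Data.List.Membership.Propositional.Properties using (∈-++⁺ˡ; ∈-++⁺ʳ; ∈-++⁻; ∈-map⁻)
  open import Data.List.Relation.Unary.Any using (here)
  open import Data.List.Relation.Unary.All as All using (All)
  open import Data.Product using (_×_; _,_; proj₁; proj₂)
  open import Data.Sum as Sum using (_⊎_; inj₁; inj₂)
  open import Data.Empty using (⊥-elim)
  open import Function using (_∘_)
  open import Function.Properties.Equivalence using () renaming (sym to ⇔-sym; trans to infixr 5 _⟨⇔⟩_)
  open import Relation.Binary.PropositionalEquality using (_≡_; _≢_; ≢-sym; refl; sym; trans; cong; cong₂; subst; module ≡-Reasoning)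
  open import Relation.Nullary using (yes; no)

  -- The ring solver accepts only variables as atoms, so the ends lo = (1 - Λ)N and
  -- peak = (Λ + 1)N of mid Λ and the top (Λ + 2)N of even Λ are written out in full.
  -- Goals under a with are normalised past what the solver can read, so the solver is
  -- only called in lemmas without with-clauses.
  module Construction (N : ℤ) (2≤N : + 2 ≤ N) where

    0≤N-2 : 0ℤ ≤ N - + 2
    0≤N-2 = ≤⇒0≤ 2≤N

    0≤N : 0ℤ ≤ N
    0≤N = ≤-by (0≤N-2 ⊞ 0≤+ 2) (solve (N ∷ []))

    1≤N : + 1 ≤ N
    1≤N = ≤-by (0≤N-2 ⊞ 0≤+ 1) (solve (N ∷ []))

    N<2N : N < + 2 * N
    N<2N = <-by (0≤N-2 ⊞ 0≤+ 1) (solve (N ∷ []))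

    mid : ℤ → List ℤ
    mid Λ = remove N (interval ((+ 1 - Λ) * N) ((Λ + + 1) * N))

    even : ℤ → List ℤ
    even Λ = mid Λ ++ (Λ + + 2) * N ∷ []

    odd : List ℤ → List ℤ → ℤ → List ℤ
    odd L R Λ = shift L (- (Λ * N) - + 1) ++ mid Λ ++ shift R (Λ * N)

    ∈-mid⁺ : ∀ Λ x → (+ 1 - Λ) * N ≤ x → x ≤ (Λ + + 1) * N → x ≢ N → x ∈ mid Λ
    ∈-mid⁺ _ _ lo≤x x≤hi x≢N = ∈-remove⁺ (∈-interval⁺ _ _ lo≤x x≤hi) x≢N

    ∈-mid⁻ : ∀ Λ {x} → x ∈ mid Λ → (+ 1 - Λ) * N ≤ x × x ≤ (Λ + + 1) * N
    ∈-mid⁻ _ x∈ = ∈-interval⁻ _ _ (proj₁ (∈-remove⁻ _ x∈))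

    mid-≢ : ∀ Λ {x} → x ∈ mid Λ → x ≢ N
    mid-≢ Λ x∈ = proj₂ (∈-remove⁻ (interval ((+ 1 - Λ) * N) ((Λ + + 1) * N)) x∈)

    module EvenTerm (Λ : ℤ) (1≤Λ : + 1 ≤ Λ) where

      0≤Λ-1 : 0ℤ ≤ Λ - + 1
      0≤Λ-1 = ≤⇒0≤ 1≤Λ

      0≤Λ : 0ℤ ≤ Λ
      0≤Λ = ≤-by (0≤Λ-1 ⊞ 0≤+ 1) (solve (Λ ∷ []))

      0≤ΛN : 0ℤ ≤ Λ * N
      0≤ΛN = *-nonNeg 0≤Λ 0≤N

      0≤[Λ-1]N : 0ℤ ≤ (Λ - + 1) * N
      0≤[Λ-1]N = *-nonNeg 0≤Λ-1 0≤N

      mid⊆even : ∀ {x} → x ∈ mid Λ → x ∈ even Λ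
      mid⊆even = ∈-++⁺ˡ

      top∈even : (Λ + + 2) * N ∈ even Λ
      top∈even = ∈-++⁺ʳ (mid Λ) (here refl)

      ∈-even⁻ : ∀ {x} → x ∈ even Λ → x ∈ mid Λ ⊎ x ≡ (Λ + + 2) * N
      ∈-even⁻ x∈ with ∈-++⁻ (mid Λ) x∈
      ... | inj₁ x∈mid        = inj₁ x∈mid
      ... | inj₂ (here x≡top) = inj₂ x≡top

      lo≤0 : (+ 1 - Λ) * N ≤ 0ℤ
      lo≤0 = ≤-by 0≤[Λ-1]N (solve (Λ ∷ N ∷ []))

      N<peak : N < (Λ + + 1) * N
      N<peak = <-by (0≤[Λ-1]N ⊞ 0≤N-2 ⊞ 0≤+ 1) (solve (Λ ∷ N ∷ []))

      peak≤top : (Λ + + 1) * N ≤ (Λ + + 2) * N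
      peak≤top = ≤-by 0≤N (solve (Λ ∷ N ∷ []))

      lo≤top : (+ 1 - Λ) * N ≤ (Λ + + 2) * N
      lo≤top = ≤-by (0≤ΛN ⊞ 0≤ΛN ⊞ 0≤N) (solve (Λ ∷ N ∷ []))

      -ΛN≤lo : - (Λ * N) ≤ (+ 1 - Λ) * N
      -ΛN≤lo = ≤-by 0≤N (solve (Λ ∷ N ∷ []))

      lo≤peak : (+ 1 - Λ) * N ≤ (Λ + + 1) * N
      lo≤peak = ℤP.≤-trans lo≤0 (ℤP.≤-trans 0≤N (ℤP.<⇒≤ N<peak))

      lo<N : (+ 1 - Λ) * N < N
      lo<N = <-by (0≤[Λ-1]N ⊞ 0≤N-2 ⊞ 0≤+ 1) (solve (Λ ∷ N ∷ []))

      0∈mid : 0ℤ ∈ mid Λ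
      0∈mid = ∈-mid⁺ Λ 0ℤ lo≤0 (ℤP.≤-trans 0≤N (ℤP.<⇒≤ N<peak)) (ℤP.<⇒≢ 0<N)
        where
        0<N : 0ℤ < N
        0<N = <-by (0≤N-2 ⊞ 0≤+ 1) (solve (N ∷ []))

      lo∈mid : (+ 1 - Λ) * N ∈ mid Λ
      lo∈mid = ∈-mid⁺ Λ ((+ 1 - Λ) * N) ℤP.≤-refl lo≤peak (ℤP.<⇒≢ lo<N)

      peak∈mid : (Λ + + 1) * N ∈ mid Λ
      peak∈mid = ∈-mid⁺ Λ ((Λ + + 1) * N) lo≤peak ℤP.≤-refl (≢-sym (ℤP.<⇒≢ N<peak))

      even-bounds : ∀ {x} → x ∈ even Λ → (+ 1 - Λ) * N ≤ x × x ≤ (Λ + + 2) * N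
      even-bounds x∈ with ∈-even⁻ x∈
      ... | inj₁ x∈mid = let lo≤x , x≤peak = ∈-mid⁻ Λ x∈mid in lo≤x , ℤP.≤-trans x≤peak peak≤top
      ... | inj₂ refl  = lo≤top , ℤP.≤-refl

      diam-even : diam (even Λ) ≡ (Λ + + 2) * N - (+ 1 - Λ) * N
      diam-even = diam≡ (mid⊆even lo∈mid) top∈even even-bounds

      small∈even⊖even : ∀ {x} → 0ℤ ≤ x → x < N → x ∈ even Λ ⊖ even Λ
      small∈even⊖even {x} 0≤x x<N =
        ∈-⊖⁺ {x = x} (mid⊆even (∈-mid⁺ Λ x (ℤP.≤-trans lo≤0 0≤x)
                                          (ℤP.≤-trans (ℤP.<⇒≤ x<N) (ℤP.<⇒≤ N<peak))
                                          (ℤP.<⇒≢ x<N)))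
             (mid⊆even 0∈mid) (solve (x ∷ []))

      peak∈even⊖even : (Λ + + 1) * N ∈ even Λ ⊖ even Λ
      peak∈even⊖even = ∈-⊖⁺ {x = (Λ + + 1) * N} (mid⊆even peak∈mid) (mid⊆even 0∈mid) (solve (Λ ∷ N ∷ []))

      large∈even⊖even : ∀ {x} → N ≤ x → x ≤ (Λ + + 2) * N - (+ 1 - Λ) * N → x ≢ (Λ + + 1) * N →
                        x ∈ even Λ ⊖ even Λ
      large∈even⊖even {x} N≤x x≤ x≢peak =
        ∈-⊖⁺ {x = x} top∈even (mid⊆even (∈-mid⁺ Λ ((Λ + + 2) * N - x) (≤-by (≤⇒0≤ x≤) (solve (x ∷ Λ ∷ N ∷ [])))
                                          (≤-by (≤⇒0≤ N≤x) (solve (x ∷ Λ ∷ N ∷ [])))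
                                          top-x≢N))
             (solve (x ∷ Λ ∷ N ∷ []))
        where
        top-x≢N : (Λ + + 2) * N - x ≢ N
        top-x≢N top-x≡N = x≢peak (begin
          x                                   ≡⟨ solve (x ∷ Λ ∷ N ∷ []) ⟩
          (Λ + + 2) * N - ((Λ + + 2) * N - x) ≡⟨ cong (λ t → (Λ + + 2) * N - t) top-x≡N ⟩
          (Λ + + 2) * N - N                   ≡⟨ solve (Λ ∷ N ∷ []) ⟩
          (Λ + + 1) * N                       ∎)
          where open ≡-Reasoning

      nonNeg∈even⊖even : ∀ {x} → 0ℤ ≤ x → x ≤ (Λ + + 2) * N - (+ 1 - Λ) * N → x ∈ even Λ ⊖ even Λ
      nonNeg∈even⊖even {x} 0≤x x≤ with x ℤ.<? N | x ℤ.≟ (Λ + + 1) * N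
      ... | yes x<N | _         = small∈even⊖even 0≤x x<N
      ... | no _    | yes refl  = peak∈even⊖even
      ... | no x≮N  | no x≢peak = large∈even⊖even (ℤP.≮⇒≥ x≮N) x≤ x≢peak

      even⊖even-full : interval ((+ 1 - Λ) * N - (Λ + + 2) * N) ((Λ + + 2) * N - (+ 1 - Λ) * N) ⊆ˢ (even Λ ⊖ even Λ)
      even⊖even-full x x∈ with ∈-interval⁻ ((+ 1 - Λ) * N - (Λ + + 2) * N) ((Λ + + 2) * N - (+ 1 - Λ) * N) x∈
                              | 0ℤ ℤ.≤? x
      ... | _ , x≤ | yes 0≤x = nonNeg∈even⊖even 0≤x x≤
      ... | ≤x , _ | no 0≰x  = subst (_∈ _) (ℤP.neg-involutive x)
        (⊖-neg (even Λ) (even Λ) (nonNeg∈even⊖even (ℤP.<⇒≤ (ℤP.neg-mono-< (ℤP.≰⇒> 0≰x)))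
                                 (subst (- x ≤_) (-[i-j]≡j-i ((+ 1 - Λ) * N) ((Λ + + 2) * N)) (ℤP.neg-mono-≤ ≤x))))

      card-even⊖even : + card (even Λ ⊖ even Λ) ≡ (+ 4 * Λ + + 2) * N + + 1
      card-even⊖even = trans
        (card-interval ((+ 1 - Λ) * N - (Λ + + 2) * N) ((Λ + + 2) * N - (+ 1 - Λ) * N)
                       (≤-by (0≤ΛN ⊞ 0≤ΛN ⊞ 0≤ΛN ⊞ 0≤ΛN ⊞ 0≤N ⊞ 0≤N ⊞ 0≤+ 1) (solve (Λ ∷ N ∷ [])))
                       (⊖-bounds even-bounds) even⊖even-full)
        (solve (Λ ∷ N ∷ []))

      even⊕even-bounds : ∀ {x} → x ∈ even Λ ⊕ even Λ →
                         ((+ 1 - Λ) * N + (+ 1 - Λ) * N ≤ x × x ≤ (Λ + + 2) * N + (Λ + + 1) * N)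
                         ⊎ x ≡ (Λ + + 2) * N + (Λ + + 2) * N
      even⊕even-bounds x∈ with ∈-⊕⁻ (even Λ) (even Λ) x∈
      ... | a , b , a∈ , b∈ , refl with ∈-even⁻ a∈ | ∈-even⁻ b∈
      ... | inj₂ refl  | inj₂ refl  = inj₂ refl
      ... | inj₁ a∈mid | _          = inj₁ (proj₁ (⊕-bounds even-bounds x∈) ,
        ℤP.≤-trans (ℤP.+-mono-≤ (proj₂ (∈-mid⁻ Λ a∈mid)) (proj₂ (even-bounds b∈)))
                   (ℤP.≤-reflexive (ℤP.+-comm ((Λ + + 1) * N) ((Λ + + 2) * N))))
      ... | inj₂ refl  | inj₁ b∈mid = inj₁ (proj₁ (⊕-bounds even-bounds x∈) ,
        ℤP.+-monoʳ-≤ ((Λ + + 2) * N) (proj₂ (∈-mid⁻ Λ b∈mid)))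

      card-even⊕even≤ : + card (even Λ ⊕ even Λ) ≤ (+ 4 * Λ + + 1) * N + + 2
      card-even⊕even≤ = ℤP.≤-trans
        (card≤interval∪point ((+ 1 - Λ) * N + (+ 1 - Λ) * N) ((Λ + + 2) * N + (Λ + + 1) * N) ((Λ + + 2) * N + (Λ + + 2) * N)
          (≤-by (0≤ΛN ⊞ 0≤ΛN ⊞ 0≤ΛN ⊞ 0≤ΛN ⊞ 0≤N ⊞ 0≤+ 1) (solve (Λ ∷ N ∷ [])))
          (<-by (0≤N-2 ⊞ 0≤+ 1) (solve (Λ ∷ N ∷ [])))
          even⊕even-bounds)
        (ℤP.≤-reflexive (solve (Λ ∷ N ∷ [])))

      even-MDTS : MDTS (even Λ)
      even-MDTS = ℤP.drop‿+<+ (begin-strict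
        + card (even Λ ⊕ even Λ)        ≤⟨ card-even⊕even≤ ⟩
        (+ 4 * Λ + + 1) * N + + 2       <⟨ <-by 0≤N-2 (solve (Λ ∷ N ∷ [])) ⟩
        (+ 4 * Λ + + 2) * N + + 1       ≡⟨ card-even⊖even ⟨
        + card (even Λ ⊖ even Λ)        ∎)
        where open ℤP.≤-Reasoning

      -- Sums are found as a + (x - a) with a ∈ {lo, peak, top} and x - a ∈ mid Λ; this
      -- fails only for x = lo + N and x = peak + N, which are (lo + 1) + (N - 1) and
      -- (peak - 1) + (N + 1).
      ∈even⊕even-via : ∀ {a x} → a ∈ even Λ → a + (+ 1 - Λ) * N ≤ x → x ≤ a + (Λ + + 1) * N → x ≢ a + N →
                       x ∈ even Λ ⊕ even Λ
      ∈even⊕even-via {a} {x} a∈ a+lo≤x x≤a+peak x≢a+N =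
        ∈-⊕⁺ {x = x} a∈ (mid⊆even (∈-mid⁺ Λ (x - a) (≤-by (≤⇒0≤ a+lo≤x) (solve (a ∷ x ∷ Λ ∷ N ∷ [])))
                                                    (≤-by (≤⇒0≤ x≤a+peak) (solve (a ∷ x ∷ Λ ∷ N ∷ [])))
                                                    x-a≢N))
             (solve (a ∷ x ∷ []))
        where
        x-a≢N : x - a ≢ N
        x-a≢N x-a≡N = x≢a+N (begin
          x           ≡⟨ solve (a ∷ x ∷ []) ⟩
          a + (x - a) ≡⟨ cong (λ t → a + t) x-a≡N ⟩
          a + N       ∎)
          where open ≡-Reasoning

      ∈even⊕even-via-except : ∀ {a x} → a ∈ even Λ → a + (+ 1 - Λ) * N ≤ x → x ≤ a + (Λ + + 1) * N →
                              a + N ∈ even Λ ⊕ even Λ → x ∈ even Λ ⊕ even Λ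
      ∈even⊕even-via-except {a} {x} a∈ a+lo≤x x≤a+peak a+N∈ with x ℤ.≟ a + N
      ... | yes refl  = a+N∈
      ... | no x≢a+N = ∈even⊕even-via a∈ a+lo≤x x≤a+peak x≢a+N

      lo+N∈even⊕even : (+ 1 - Λ) * N + N ∈ even Λ ⊕ even Λ
      lo+N∈even⊕even = ∈-⊕⁺ {x = (+ 1 - Λ) * N + N} (mid⊆even lo+1∈mid) (mid⊆even N-1∈mid) (solve (Λ ∷ N ∷ []))
        where
        lo+1<N : (+ 1 - Λ) * N + + 1 < N
        lo+1<N = <-by (0≤[Λ-1]N ⊞ 0≤N-2) (solve (Λ ∷ N ∷ []))
        lo+1∈mid : (+ 1 - Λ) * N + + 1 ∈ mid Λ
        lo+1∈mid = ∈-mid⁺ Λ ((+ 1 - Λ) * N + + 1) (≤-by (0≤+ 1) (solve (Λ ∷ N ∷ [])))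
          (≤-by (0≤ΛN ⊞ 0≤[Λ-1]N ⊞ 0≤N-2 ⊞ 0≤+ 1) (solve (Λ ∷ N ∷ []))) (ℤP.<⇒≢ lo+1<N)
        N-1<N : N - + 1 < N
        N-1<N = <-by (0≤+ 0) (solve (N ∷ []))
        N-1∈mid : N - + 1 ∈ mid Λ
        N-1∈mid = ∈-mid⁺ Λ (N - + 1) (≤-by (0≤[Λ-1]N ⊞ 0≤N-2 ⊞ 0≤+ 1) (solve (Λ ∷ N ∷ [])))
          (≤-by (0≤ΛN ⊞ 0≤+ 1) (solve (Λ ∷ N ∷ []))) (ℤP.<⇒≢ N-1<N)

      peak+N∈even⊕even : (Λ + + 1) * N + N ∈ even Λ ⊕ even Λ
      peak+N∈even⊕even = ∈-⊕⁺ {x = (Λ + + 1) * N + N} (mid⊆even peak-1∈mid) (mid⊆even N+1∈mid) (solve (Λ ∷ N ∷ []))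
        where
        N<peak-1 : N < (Λ + + 1) * N - + 1
        N<peak-1 = <-by (0≤[Λ-1]N ⊞ 0≤N-2) (solve (Λ ∷ N ∷ []))
        peak-1∈mid : (Λ + + 1) * N - + 1 ∈ mid Λ
        peak-1∈mid = ∈-mid⁺ Λ ((Λ + + 1) * N - + 1) (≤-by (0≤ΛN ⊞ 0≤[Λ-1]N ⊞ 0≤N-2 ⊞ 0≤+ 1) (solve (Λ ∷ N ∷ [])))
          (≤-by (0≤+ 1) (solve (Λ ∷ N ∷ []))) (≢-sym (ℤP.<⇒≢ N<peak-1))
        N<N+1 : N < N + + 1
        N<N+1 = <-by (0≤+ 0) (solve (N ∷ []))
        N+1∈mid : N + + 1 ∈ mid Λ
        N+1∈mid = ∈-mid⁺ Λ (N + + 1) (≤-by (0≤ΛN ⊞ 0≤+ 1) (solve (Λ ∷ N ∷ [])))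
          (≤-by (0≤[Λ-1]N ⊞ 0≤N-2 ⊞ 0≤+ 1) (solve (Λ ∷ N ∷ []))) (≢-sym (ℤP.<⇒≢ N<N+1))

      high∈even⊕even : ∀ {x} → (Λ + + 1) * N + (Λ + + 1) * N < x → x ≤ (Λ + + 2) * N + (Λ + + 1) * N →
                       x ∈ even Λ ⊕ even Λ
      high∈even⊕even {x} 2peak<x x≤top+peak = ∈even⊕even-via {x = x} top∈even
        (≤-by (<⇒0≤ 2peak<x ⊞ 0≤+ 1 ⊞ 0≤ΛN ⊞ 0≤[Λ-1]N) (solve (x ∷ Λ ∷ N ∷ [])))
        x≤top+peak
        (≢-sym (ℤP.<⇒≢ top+N<x))
        where
        top+N<x : (Λ + + 2) * N + N < x
        top+N<x = <-by (<⇒0≤ 2peak<x ⊞ 0≤[Λ-1]N) (solve (x ∷ Λ ∷ N ∷ []))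

      even⊕even-full : interval ((+ 1 - Λ) * N + (+ 1 - Λ) * N) ((Λ + + 2) * N + (Λ + + 1) * N) ⊆ˢ (even Λ ⊕ even Λ)
      even⊕even-full x x∈ with ∈-interval⁻ ((+ 1 - Λ) * N + (+ 1 - Λ) * N) ((Λ + + 2) * N + (Λ + + 1) * N) x∈
                              | x ℤ.≤? (+ 1 - Λ) * N + (Λ + + 1) * N | x ℤ.≤? (Λ + + 1) * N + (Λ + + 1) * N
      ... | 2lo≤x , _ | yes x≤lo+peak | _ = ∈even⊕even-via-except (mid⊆even lo∈mid) 2lo≤x x≤lo+peak lo+N∈even⊕even
      ... | _ | no x≰lo+peak | yes x≤2peak =
        ∈even⊕even-via-except (mid⊆even peak∈mid)
          (subst (_≤ x) (ℤP.+-comm ((+ 1 - Λ) * N) ((Λ + + 1) * N)) (ℤP.<⇒≤ (ℤP.≰⇒> x≰lo+peak)))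
          x≤2peak peak+N∈even⊕even
      ... | _ , x≤top+peak | no _ | no x≰2peak = high∈even⊕even (ℤP.≰⇒> x≰2peak) x≤top+peak

    module Odd (L R : List ℤ)
               (L-bounds : ∀ {x} → x ∈ L → + 1 ≤ x × x ≤ N)
               (R-bounds : ∀ {x} → x ∈ R → N < x × x ≤ + 2 * N)
               (1∈A : + 1 ∈ L ++ R) (2N∈A : + 2 * N ∈ L ++ R) where

      A : List ℤ
      A = L ++ R

      1∈L : + 1 ∈ L
      1∈L with ∈-++⁻ L 1∈A
      ... | inj₁ 1∈L = 1∈L
      ... | inj₂ 1∈R = ⊥-elim (ℤP.<⇒≱ (proj₁ (R-bounds 1∈R)) 1≤N)

      2N∈R : + 2 * N ∈ R
      2N∈R with ∈-++⁻ L 2N∈A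
      ... | inj₁ 2N∈L = ⊥-elim (ℤP.<⇒≱ N<2N (proj₂ (L-bounds 2N∈L)))
      ... | inj₂ 2N∈R = 2N∈R

      A-bounds : ∀ {x} → x ∈ A → + 1 ≤ x × x ≤ + 2 * N
      A-bounds x∈ with ∈-++⁻ L x∈
      ... | inj₁ x∈L = let 1≤x , x≤N = L-bounds x∈L in 1≤x , ℤP.≤-trans x≤N (ℤP.<⇒≤ N<2N)
      ... | inj₂ x∈R = let N<x , x≤2N = R-bounds x∈R in ℤP.≤-trans 1≤N (ℤP.<⇒≤ N<x) , x≤2N

      ends-A : Ends A L R (+ 1) (+ 1 + N) N (+ 2 * N)
      ends-A = record
        { bounds  = A-bounds
        ; Lo⊆     = λ _ → ∈-++⁺ˡ
        ; Hi⊆     = λ _ → ∈-++⁺ʳ L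
        ; Lo-or-≥ = λ x∈ → Sum.map₂ (ℤP.i<j⇒suc[i]≤j ∘ proj₁ ∘ R-bounds) (∈-++⁻ L x∈)
        ; Hi-or-≤ = λ x∈ → Sum.swap (Sum.map₁ (proj₂ ∘ L-bounds) (∈-++⁻ L x∈))
        }

      A⊆even₁ : N ∉ A → A ⊆ˢ even (+ 1)
      A⊆even₁ N∉A x x∈ = ∈-++⁺ˡ (∈-mid⁺ (+ 1) x (≤-by (≤⇒0≤ 1≤x ⊞ 0≤+ 1) (solve (x ∷ N ∷ [])))
                                              (≤-by (≤⇒0≤ x≤2N) (solve (x ∷ N ∷ [])))
                                              (λ x≡N → N∉A (subst (_∈ A) x≡N x∈)))
        where
        1≤x = proj₁ (A-bounds x∈)
        x≤2N = proj₂ (A-bounds x∈)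

      A⊕A-below A⊕A-above A⊖A-below A⊖A-above : ℕ
      A⊕A-below = count (A ⊕ A) (interval (+ 1 + + 1) (+ 2 * + 1 + N - + 1))
      A⊕A-above = count (A ⊕ A) (interval (+ 1 + (+ 2 * (+ 2 * N) - N)) (+ 2 * N + + 2 * N))
      A⊖A-below = count (A ⊖ A) (interval (+ 1 - + 2 * N) (- (+ 2 * N - + 1) + N - + 1))
      A⊖A-above = count (A ⊖ A) (interval (+ 1 + ((+ 2 * N - + 1) - N)) (+ 2 * N - + 1))

      card-A⊕A : interval (+ 2 * + 1 + N) (+ 2 * (+ 2 * N) - N) ⊆ˢ (A ⊕ A) →
                 + card (A ⊕ A) ≡ + A⊕A-below + ((+ 2 * (+ 2 * N) - N) - (+ 2 * + 1 + N) + + 1) + + A⊕A-above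
      card-A⊕A sums = card-by-blocks (+ 1 + + 1) (+ 2 * + 1 + N) (+ 2 * (+ 2 * N) - N) (+ 2 * N + + 2 * N)
        (≤-by 0≤N (solve (N ∷ []))) (≤-by (0≤N-2 ⊞ 0≤N ⊞ 0≤+ 1) (solve (N ∷ []))) (≤-by 0≤N (solve (N ∷ [])))
        (⊕-bounds A-bounds) sums

      card-A⊖A : interval (- (+ 2 * N - + 1) + N) ((+ 2 * N - + 1) - N) ⊆ˢ (A ⊖ A) →
                 + card (A ⊖ A) ≡ + A⊖A-below + (((+ 2 * N - + 1) - N) - (- (+ 2 * N - + 1) + N) + + 1) + + A⊖A-above
      card-A⊖A diffs = card-by-blocks (+ 1 - + 2 * N) (- (+ 2 * N - + 1) + N) ((+ 2 * N - + 1) - N) (+ 2 * N - + 1)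
        (≤-by 0≤N (solve (N ∷ []))) (≤-by (0≤N-2 ⊞ 0≤N ⊞ 0≤+ 1) (solve (N ∷ []))) (≤-by 0≤N (solve (N ∷ [])))
        (⊖-bounds A-bounds) diffs

      module OddTerm (Λ : ℤ) (1≤Λ : + 1 ≤ Λ) where
        open EvenTerm Λ 1≤Λ

        L′ : List ℤ
        L′ = shift L (- (Λ * N) - + 1)

        R′ : List ℤ
        R′ = shift R (Λ * N)

        shiftL-bounds : ∀ {a} → a ∈ L → - (Λ * N) ≤ a + (- (Λ * N) - + 1) × a + (- (Λ * N) - + 1) < (+ 1 - Λ) * N
        shiftL-bounds {a} a∈ = let 1≤a , a≤N = L-bounds a∈ in
          ≤-by (≤⇒0≤ 1≤a) (solve (a ∷ Λ ∷ N ∷ [])) , <-by (≤⇒0≤ a≤N) (solve (a ∷ Λ ∷ N ∷ []))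

        shiftR-bounds : ∀ {b} → b ∈ R → (Λ + + 1) * N < b + Λ * N × b + Λ * N ≤ (Λ + + 2) * N
        shiftR-bounds {b} b∈ = let N<b , b≤2N = R-bounds b∈ in
          <-by (<⇒0≤ N<b) (solve (b ∷ Λ ∷ N ∷ [])) , ≤-by (≤⇒0≤ b≤2N) (solve (b ∷ Λ ∷ N ∷ []))

        L′-bounds : ∀ {x} → x ∈ L′ → - (Λ * N) ≤ x × x < (+ 1 - Λ) * N
        L′-bounds x∈ with ∈-map⁻ (_+ (- (Λ * N) - + 1)) x∈
        ... | a , a∈ , refl = shiftL-bounds a∈

        R′-bounds : ∀ {x} → x ∈ R′ → (Λ + + 1) * N < x × x ≤ (Λ + + 2) * N
        R′-bounds x∈ with ∈-map⁻ (_+ Λ * N) x∈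
        ... | b , b∈ , refl = shiftR-bounds b∈

        ∈-odd⁻ : ∀ {x} → x ∈ odd L R Λ → x ∈ L′ ⊎ x ∈ mid Λ ⊎ x ∈ R′
        ∈-odd⁻ x∈ = Sum.map₂ (∈-++⁻ (mid Λ)) (∈-++⁻ L′ x∈)

        odd-bounds : ∀ {x} → x ∈ odd L R Λ → - (Λ * N) ≤ x × x ≤ (Λ + + 2) * N
        odd-bounds x∈ with ∈-odd⁻ x∈
        ... | inj₁ x∈L′ = let m≤x , x<lo = L′-bounds x∈L′ in m≤x , ℤP.≤-trans (ℤP.<⇒≤ x<lo) lo≤top
        ... | inj₂ (inj₁ x∈mid) = let lo≤x , x≤peak = ∈-mid⁻ Λ x∈mid in
                                  ℤP.≤-trans -ΛN≤lo lo≤x , ℤP.≤-trans x≤peak peak≤top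
        ... | inj₂ (inj₂ x∈R′) = let peak<x , x≤top = R′-bounds x∈R′ in
                                 ℤP.≤-trans (ℤP.≤-trans -ΛN≤lo lo≤peak) (ℤP.<⇒≤ peak<x) , x≤top

        ends-odd : Ends (odd L R Λ) L′ R′ (- (Λ * N)) ((+ 1 - Λ) * N) ((Λ + + 1) * N) ((Λ + + 2) * N)
        ends-odd = record
          { bounds  = odd-bounds
          ; Lo⊆     = λ _ → ∈-++⁺ˡ
          ; Hi⊆     = λ _ x∈ → ∈-++⁺ʳ L′ (∈-++⁺ʳ (mid Λ) x∈)
          ; Lo-or-≥ = Lo-or-≥
          ; Hi-or-≤ = Hi-or-≤
          }
          where
          Lo-or-≥ : ∀ {x} → x ∈ odd L R Λ → x ∈ L′ ⊎ (+ 1 - Λ) * N ≤ x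
          Lo-or-≥ x∈ with ∈-odd⁻ x∈
          ... | inj₁ x∈L′         = inj₁ x∈L′
          ... | inj₂ (inj₁ x∈mid) = inj₂ (proj₁ (∈-mid⁻ Λ x∈mid))
          ... | inj₂ (inj₂ x∈R′)  = inj₂ (ℤP.≤-trans lo≤peak (ℤP.<⇒≤ (proj₁ (R′-bounds x∈R′))))
          Hi-or-≤ : ∀ {x} → x ∈ odd L R Λ → x ∈ R′ ⊎ x ≤ (Λ + + 1) * N
          Hi-or-≤ x∈ with ∈-odd⁻ x∈
          ... | inj₁ x∈L′         = inj₂ (ℤP.≤-trans (ℤP.<⇒≤ (proj₂ (L′-bounds x∈L′))) lo≤peak)
          ... | inj₂ (inj₁ x∈mid) = inj₂ (proj₂ (∈-mid⁻ Λ x∈mid))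
          ... | inj₂ (inj₂ x∈R′)  = inj₁ x∈R′

        top∈odd : (Λ + + 2) * N ∈ odd L R Λ
        top∈odd = ∈-++⁺ʳ L′ (∈-++⁺ʳ (mid Λ) (∈-shift⁺ 2N∈R top≡2N+ΛN))
          where
          top≡2N+ΛN : (Λ + + 2) * N ≡ + 2 * N + Λ * N
          top≡2N+ΛN = solve (Λ ∷ N ∷ [])

        -ΛN∈odd : - (Λ * N) ∈ odd L R Λ
        -ΛN∈odd = ∈-++⁺ˡ (∈-shift⁺ 1∈L -ΛN≡1-ΛN-1)
          where
          -ΛN≡1-ΛN-1 : - (Λ * N) ≡ + 1 + (- (Λ * N) - + 1)
          -ΛN≡1-ΛN-1 = solve (Λ ∷ N ∷ [])

        even⊆odd : even Λ ⊆ˢ odd L R Λ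
        even⊆odd x x∈ with ∈-even⁻ x∈
        ... | inj₁ x∈mid = ∈-++⁺ʳ L′ (∈-++⁺ˡ x∈mid)
        ... | inj₂ refl  = top∈odd

        diam-odd : diam (odd L R Λ) ≡ (Λ + + 2) * N - - (Λ * N)
        diam-odd = diam≡ -ΛN∈odd top∈odd odd-bounds

        odd⊆even-next : odd L R Λ ⊆ˢ even (+ 1 + Λ)
        odd⊆even-next x x∈ =
          ∈-++⁺ˡ (∈-mid⁺ (+ 1 + Λ) x (lower (proj₁ (odd-bounds x∈))) (upper (proj₂ (odd-bounds x∈))) x≢N)
          where
          lower : - (Λ * N) ≤ x → (+ 1 - (+ 1 + Λ)) * N ≤ x
          lower -ΛN≤x = ≤-by (≤⇒0≤ -ΛN≤x) (solve (x ∷ Λ ∷ N ∷ []))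
          upper : x ≤ (Λ + + 2) * N → x ≤ (+ 1 + Λ + + 1) * N
          upper x≤top = ≤-by (≤⇒0≤ x≤top) (solve (x ∷ Λ ∷ N ∷ []))
          x≢N : x ≢ N
          x≢N with ∈-odd⁻ x∈
          ... | inj₁ x∈L′         = ℤP.<⇒≢ (ℤP.<-trans (proj₂ (L′-bounds x∈L′)) lo<N)
          ... | inj₂ (inj₁ x∈mid) = mid-≢ Λ x∈mid
          ... | inj₂ (inj₂ x∈R′)  = ≢-sym (ℤP.<⇒≢ (ℤP.<-trans N<peak (proj₁ (R′-bounds x∈R′))))

        low∈odd⊕odd : ∀ {x} → - (Λ * N) + (+ 1 - Λ) * N ≤ x → x < (+ 1 - Λ) * N + (+ 1 - Λ) * N →
                      x ∈ odd L R Λ ⊕ odd L R Λ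
        low∈odd⊕odd {x} b≤x x<2lo =
          ∈-⊕⁺ {x = x} -ΛN∈odd
            (even⊆odd _ (mid⊆even (∈-mid⁺ Λ (x + Λ * N) (≤-by (≤⇒0≤ b≤x) (solve (x ∷ Λ ∷ N ∷ [])))
                                                        (≤-by (<⇒0≤ x<2lo ⊞ 0≤+ 1 ⊞ 0≤ΛN ⊞ 0≤[Λ-1]N) (solve (x ∷ Λ ∷ N ∷ [])))
                                                        (ℤP.<⇒≢ x+ΛN<N))))
            (solve (x ∷ Λ ∷ N ∷ []))
          where
          x+ΛN<N : x + Λ * N < N
          x+ΛN<N = <-by (<⇒0≤ x<2lo ⊞ 0≤[Λ-1]N) (solve (x ∷ Λ ∷ N ∷ []))

        odd⊕odd-full : interval (- (Λ * N) + (+ 1 - Λ) * N) ((Λ + + 2) * N + (Λ + + 1) * N) ⊆ˢ (odd L R Λ ⊕ odd L R Λ)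
        odd⊕odd-full x x∈ with ∈-interval⁻ (- (Λ * N) + (+ 1 - Λ) * N) ((Λ + + 2) * N + (Λ + + 1) * N) x∈
                             | x ℤ.<? (+ 1 - Λ) * N + (+ 1 - Λ) * N
        ... | b≤x , _  | yes x<2lo = low∈odd⊕odd b≤x x<2lo
        ... | _ , x≤c | no x≮2lo  = ⊕-mono even⊆odd even⊆odd x
          (even⊕even-full x (∈-interval⁺ ((+ 1 - Λ) * N + (+ 1 - Λ) * N) ((Λ + + 2) * N + (Λ + + 1) * N)
                                         (ℤP.≮⇒≥ x≮2lo) x≤c))

        odd⊖odd-full : interval ((+ 1 - Λ) * N - (Λ + + 2) * N) ((Λ + + 2) * N - (+ 1 - Λ) * N) ⊆ˢ (odd L R Λ ⊖ odd L R Λ)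
        odd⊖odd-full x x∈ = ⊖-mono even⊆odd even⊆odd x (even⊖even-full x x∈)

        -- Near its ends, odd ± odd agrees with a translate of L + L, R + R, L - R or R - L
        -- (by Ends), and so does A ± A near its ends.
        odd⊕odd-below : count (odd L R Λ ⊕ odd L R Λ) (interval (- (Λ * N) + - (Λ * N)) (- (Λ * N) + (+ 1 - Λ) * N - + 1))
                        ≡ A⊕A-below
        odd⊕odd-below = count-interval-shift
          (- (Λ * N) + - (Λ * N)) (- (Λ * N) + (+ 1 - Λ) * N - + 1) (- ((- (Λ * N) - + 1) + (- (Λ * N) - + 1)))
          (+ 1 + + 1) (+ 2 * + 1 + N - + 1) (solve (Λ ∷ N ∷ [])) (solve (Λ ∷ N ∷ []))
          (λ {x} _ x≤ →
            ⊕-low ends-odd {x = x} (<-by (≤⇒0≤ x≤) (solve (x ∷ Λ ∷ N ∷ [])))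
            ⟨⇔⟩ ∈-shift⊕shift L (- (Λ * N) - + 1) L (- (Λ * N) - + 1)
            ⟨⇔⟩ ⇔-sym (⊕-low ends-A {x = x - ((- (Λ * N) - + 1) + (- (Λ * N) - + 1))}
                               (<-by (≤⇒0≤ x≤) (solve (x ∷ Λ ∷ N ∷ [])))))

        odd⊕odd-above : count (odd L R Λ ⊕ odd L R Λ) (interval (+ 1 + ((Λ + + 2) * N + (Λ + + 1) * N)) ((Λ + + 2) * N + (Λ + + 2) * N))
                        ≡ A⊕A-above
        odd⊕odd-above = count-interval-shift
          (+ 1 + ((Λ + + 2) * N + (Λ + + 1) * N)) ((Λ + + 2) * N + (Λ + + 2) * N) (- (Λ * N + Λ * N))
          (+ 1 + (+ 2 * (+ 2 * N) - N)) (+ 2 * N + + 2 * N) (solve (Λ ∷ N ∷ [])) (solve (Λ ∷ N ∷ []))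
          (λ {x} 1+c≤x _ →
            ⊕-high ends-odd {x = x} (<-by (≤⇒0≤ 1+c≤x) (solve (x ∷ Λ ∷ N ∷ [])))
            ⟨⇔⟩ ∈-shift⊕shift R (Λ * N) R (Λ * N)
            ⟨⇔⟩ ⇔-sym (⊕-high ends-A {x = x - (Λ * N + Λ * N)}
                                (<-by (≤⇒0≤ 1+c≤x) (solve (x ∷ Λ ∷ N ∷ [])))))

        odd⊖odd-below : count (odd L R Λ ⊖ odd L R Λ) (interval (- (Λ * N) - (Λ + + 2) * N) ((+ 1 - Λ) * N - (Λ + + 2) * N - + 1))
                        ≡ A⊖A-below
        odd⊖odd-below = count-interval-shift
          (- (Λ * N) - (Λ + + 2) * N) ((+ 1 - Λ) * N - (Λ + + 2) * N - + 1) (- ((- (Λ * N) - + 1) - Λ * N))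
          (+ 1 - + 2 * N) (- (+ 2 * N - + 1) + N - + 1) (solve (Λ ∷ N ∷ [])) (solve (Λ ∷ N ∷ []))
          (λ {x} _ x≤ →
            ⊖-low ends-odd {x = x} (<-by (≤⇒0≤ x≤) (solve (x ∷ Λ ∷ N ∷ [])))
                                   (<-by (≤⇒0≤ x≤) (solve (x ∷ Λ ∷ N ∷ [])))
            ⟨⇔⟩ ∈-shift⊖shift L (- (Λ * N) - + 1) R (Λ * N)
            ⟨⇔⟩ ⇔-sym (⊖-low ends-A {x = x - ((- (Λ * N) - + 1) - Λ * N)}
                               (<-by (≤⇒0≤ x≤) (solve (x ∷ Λ ∷ N ∷ []))) (<-by (≤⇒0≤ x≤) (solve (x ∷ Λ ∷ N ∷ [])))))

        odd⊖odd-above : count (odd L R Λ ⊖ odd L R Λ) (interval (+ 1 + ((Λ + + 2) * N - (+ 1 - Λ) * N)) ((Λ + + 2) * N - - (Λ * N)))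
                        ≡ A⊖A-above
        odd⊖odd-above = count-interval-shift
          (+ 1 + ((Λ + + 2) * N - (+ 1 - Λ) * N)) ((Λ + + 2) * N - - (Λ * N)) (- (Λ * N - (- (Λ * N) - + 1)))
          (+ 1 + ((+ 2 * N - + 1) - N)) (+ 2 * N - + 1) (solve (Λ ∷ N ∷ [])) (solve (Λ ∷ N ∷ []))
          (λ {x} 1+c≤x _ →
            ⊖-high ends-odd {x = x} (<-by (≤⇒0≤ 1+c≤x) (solve (x ∷ Λ ∷ N ∷ [])))
                                    (<-by (≤⇒0≤ 1+c≤x) (solve (x ∷ Λ ∷ N ∷ [])))
            ⟨⇔⟩ ∈-shift⊖shift R (Λ * N) L (- (Λ * N) - + 1)
            ⟨⇔⟩ ⇔-sym (⊖-high ends-A {x = x - (Λ * N - (- (Λ * N) - + 1))}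
                               (<-by (≤⇒0≤ 1+c≤x) (solve (x ∷ Λ ∷ N ∷ []))) (<-by (≤⇒0≤ 1+c≤x) (solve (x ∷ Λ ∷ N ∷ [])))))

        card-odd⊕odd : + card (odd L R Λ ⊕ odd L R Λ)
                       ≡ + A⊕A-below + ((Λ + + 2) * N + (Λ + + 1) * N - (- (Λ * N) + (+ 1 - Λ) * N) + + 1) + + A⊕A-above
        card-odd⊕odd = trans
          (card-by-blocks (- (Λ * N) + - (Λ * N)) (- (Λ * N) + (+ 1 - Λ) * N) ((Λ + + 2) * N + (Λ + + 1) * N)
                          ((Λ + + 2) * N + (Λ + + 2) * N)
            (≤-by 0≤N (solve (Λ ∷ N ∷ []))) (≤-by (0≤ΛN ⊞ 0≤ΛN ⊞ 0≤ΛN ⊞ 0≤ΛN ⊞ 0≤N ⊞ 0≤N ⊞ 0≤+ 1) (solve (Λ ∷ N ∷ [])))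
            (≤-by 0≤N (solve (Λ ∷ N ∷ []))) (⊕-bounds odd-bounds) odd⊕odd-full)
          (cong₂ (λ below above → + below + ((Λ + + 2) * N + (Λ + + 1) * N - (- (Λ * N) + (+ 1 - Λ) * N) + + 1) + + above)
                 odd⊕odd-below odd⊕odd-above)

        card-odd⊖odd : + card (odd L R Λ ⊖ odd L R Λ)
                       ≡ + A⊖A-below + ((Λ + + 2) * N - (+ 1 - Λ) * N - ((+ 1 - Λ) * N - (Λ + + 2) * N) + + 1) + + A⊖A-above
        card-odd⊖odd = trans
          (card-by-blocks (- (Λ * N) - (Λ + + 2) * N) ((+ 1 - Λ) * N - (Λ + + 2) * N) ((Λ + + 2) * N - (+ 1 - Λ) * N)
                          ((Λ + + 2) * N - - (Λ * N))
            (≤-by 0≤N (solve (Λ ∷ N ∷ []))) (≤-by (0≤ΛN ⊞ 0≤ΛN ⊞ 0≤ΛN ⊞ 0≤ΛN ⊞ 0≤N ⊞ 0≤N ⊞ 0≤+ 1) (solve (Λ ∷ N ∷ [])))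
            (≤-by 0≤N (solve (Λ ∷ N ∷ []))) (⊖-bounds odd-bounds) odd⊖odd-full)
          (cong₂ (λ below above → + below + ((Λ + + 2) * N - (+ 1 - Λ) * N - ((+ 1 - Λ) * N - (Λ + + 2) * N) + + 1) + + above)
                 odd⊖odd-below odd⊖odd-above)

        -- The full middle blocks of odd ± odd both have (4Λ + 2)N + 1 elements and those of
        -- A ± A both have 2N - 1, so the two cardinality differences coincide.
        odd-MSTD : interval (+ 2 * + 1 + N) (+ 2 * (+ 2 * N) - N) ⊆ˢ (A ⊕ A) →
                   interval (- (+ 2 * N - + 1) + N) ((+ 2 * N - + 1) - N) ⊆ˢ (A ⊖ A) →
                   MSTD A → MSTD (odd L R Λ)
        odd-MSTD sums diffs A-MSTD = ℤP.drop‿+<+ (<-transfer difference (ℤ.+<+ A-MSTD))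
          where
          middles-cancel : ∀ sL sH dL dH Λ N →
            (sL + ((Λ + + 2) * N + (Λ + + 1) * N - (- (Λ * N) + (+ 1 - Λ) * N) + + 1) + sH)
              - (dL + ((Λ + + 2) * N - (+ 1 - Λ) * N - ((+ 1 - Λ) * N - (Λ + + 2) * N) + + 1) + dH)
            ≡ (sL + ((+ 2 * (+ 2 * N) - N) - (+ 2 * + 1 + N) + + 1) + sH)
              - (dL + (((+ 2 * N - + 1) - N) - (- (+ 2 * N - + 1) + N) + + 1) + dH)
          middles-cancel = solve-∀
          difference : + card (odd L R Λ ⊕ odd L R Λ) - + card (odd L R Λ ⊖ odd L R Λ) ≡ + card (A ⊕ A) - + card (A ⊖ A)
          difference = trans (cong₂ _-_ card-odd⊕odd card-odd⊖odd)
            (trans (middles-cancel (+ A⊕A-below) (+ A⊕A-above) (+ A⊖A-below) (+ A⊖A-above) Λ N)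
                   (sym (cong₂ _-_ (card-A⊕A sums) (card-A⊖A diffs))))

        diam-odd≡diam-even+N : diam (odd L R Λ) ≡ diam (even Λ) + N
        diam-odd≡diam-even+N = begin
          diam (odd L R Λ)                             ≡⟨ diam-odd ⟩
          (Λ + + 2) * N - - (Λ * N)                    ≡⟨ solve (Λ ∷ N ∷ []) ⟩
          (Λ + + 2) * N - (+ 1 - Λ) * N + N            ≡⟨ cong (_+ N) diam-even ⟨
          diam (even Λ) + N                            ∎
          where open ≡-Reasoning

        diam-even-next≡diam-odd+N : diam (even (+ 1 + Λ)) ≡ diam (odd L R Λ) + N
        diam-even-next≡diam-odd+N = begin
          diam (even (+ 1 + Λ))                        ≡⟨ EvenTerm.diam-even (+ 1 + Λ) (ℤP.≤-trans 1≤Λ (ℤP.i≤j+i Λ (+ 1))) ⟩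
          (+ 1 + Λ + + 2) * N - (+ 1 - (+ 1 + Λ)) * N  ≡⟨ solve (Λ ∷ N ∷ []) ⟩
          (Λ + + 2) * N - - (Λ * N) + N                ≡⟨ cong (_+ N) diam-odd ⟨
          diam (odd L R Λ) + N                         ∎
          where open ≡-Reasoning

  data Parity : ℕ → Set where
    2*_   : ∀ k → Parity (2 ℕ.* k)
    1+2*_ : ∀ k → Parity (suc (2 ℕ.* k))

  2[1+k]≡2+2k : ∀ k → 2 ℕ.* suc k ≡ suc (suc (2 ℕ.* k))
  2[1+k]≡2+2k k = cong suc (ℕP.+-suc k (k ℕ.+ 0))

  parity : ∀ m → Parity m
  parity zero = 2* 0
  parity (suc m) with parity m
  ... | 2* k   = 1+2* k
  ... | 1+2* k = subst Parity (2[1+k]≡2+2k k) (2* suc k)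

  2k%2≡0 : ∀ k → (2 ℕ.* k) % 2 ≡ 0
  2k%2≡0 k = %-remove-+ʳ 0 (m∣m*n {2} k)

  2k/2≡k : ∀ k → (2 ℕ.* k) / 2 ≡ k
  2k/2≡k k = trans (cong (_/ 2) (ℕP.*-comm 2 k)) (m*n/n≡m k 2)

  [1+2k]%2≡1 : ∀ k → suc (2 ℕ.* k) % 2 ≡ 1
  [1+2k]%2≡1 k = %-remove-+ʳ 1 (m∣m*n {2} k)

  [1+2k]/2≡k : ∀ k → suc (2 ℕ.* k) / 2 ≡ k
  [1+2k]/2≡k k = trans (+-distrib-/-∣ʳ 1 (m∣m*n {2} k)) (2k/2≡k k)

  seqA-even : ∀ n L R k → seqA n L R (2 ℕ.* k) ≡ Aeven n k
  seqA-even n L R k rewrite 2k%2≡0 k | 2k/2≡k k = refl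

  seqA-odd : ∀ n L R k → seqA n L R (suc (2 ℕ.* suc k)) ≡ Aodd n L R (suc k)
  seqA-odd n L R k rewrite [1+2k]%2≡1 (suc k) | [1+2k]/2≡k (suc k) = refl

  2≤n : ∀ {n A} → 1 ℕ.≤ n → + 1 ∈ A → + n ∉ A → + 2 ≤ + n
  2≤n {suc zero}    _ 1∈A n∉A = ⊥-elim (n∉A 1∈A)
  2≤n {suc (suc _)} _ _   _   = +≤+ (s≤s (s≤s z≤n))

  1≤+suc : ∀ k → + 1 ≤ + suc k
  1≤+suc k = +≤+ (s≤s z≤n)

  module SeqA (n : ℕ) (1≤n : 1 ℕ.≤ n) (L R : List ℤ)
              (L-bounds : All (λ x → (+ 1 ≤ x) × (x ≤ + n)) L)
              (R-bounds : All (λ x → (+ (suc n) ≤ x) × (x ≤ + 2 * + n)) R)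
              (1∈A : + 1 ∈ L ++ R) (2n∈A : + 2 * + n ∈ L ++ R) (n∉A : + n ∉ L ++ R) where

    open Construction (+ n) (2≤n 1≤n 1∈A n∉A)

    R-bounds′ : ∀ {x} → x ∈ R → + n ℤ.< x × x ≤ + 2 * + n
    R-bounds′ x∈ = let 1+n≤x , x≤2n = All.lookup R-bounds x∈ in ℤP.suc[i]≤j⇒i<j 1+n≤x , x≤2n

    open Odd L R (All.lookup L-bounds) R-bounds′ 1∈A 2n∈A

    seqA-even-⊆ : ∀ k → seqA n L R (2 ℕ.* suc k) ⊆ˢ seqA n L R (suc (2 ℕ.* suc k))
    seqA-even-⊆ k rewrite seqA-even n L R (suc k) | seqA-odd n L R k = OddTerm.even⊆odd (+ suc k) (1≤+suc k)

    seqA-odd-⊆ : ∀ k → seqA n L R (suc (2 ℕ.* suc k)) ⊆ˢ seqA n L R (2 ℕ.* suc (suc k))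
    seqA-odd-⊆ k rewrite seqA-odd n L R k | seqA-even n L R (suc (suc k)) = OddTerm.odd⊆even-next (+ suc k) (1≤+suc k)

    seqA-⊆ : (m : ℕ) → 1 ℕ.≤ m → seqA n L R m ⊆ˢ seqA n L R (suc m)
    seqA-⊆ m 1≤m with parity m
    seqA-⊆ _ () | 2* zero
    ... | 2* suc k    = seqA-even-⊆ k
    ... | 1+2* zero   = A⊆even₁ n∉A
    ... | 1+2* suc k  = subst (λ j → seqA n L R (suc (2 ℕ.* suc k)) ⊆ˢ seqA n L R j)
                              (2[1+k]≡2+2k (suc k)) (seqA-odd-⊆ k)

    seqA-MSTD : IsP n (+ 1) (+ 2 * + n) (L ++ R) → MSTD (L ++ R) → (l : ℕ) → 1 ℕ.≤ l → MSTD (seqA n L R (2 ℕ.* l ∸ 1))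
    seqA-MSTD _ A-MSTD (suc zero) _ = A-MSTD
    seqA-MSTD (sums , diffs) A-MSTD (suc (suc k)) _ =
      subst (λ j → MSTD (seqA n L R (j ∸ 1))) (sym (2[1+k]≡2+2k (suc k)))
        (subst MSTD (sym (seqA-odd n L R k)) (OddTerm.odd-MSTD (+ suc k) (1≤+suc k) sums diffs A-MSTD))

    seqA-MDTS : (l : ℕ) → 1 ℕ.≤ l → MDTS (seqA n L R (2 ℕ.* l))
    seqA-MDTS (suc k) _ = subst MDTS (sym (seqA-even n L R (suc k))) (EvenTerm.even-MDTS (+ suc k) (1≤+suc k))

    seqA-odd-diam : ∀ k → diam (seqA n L R (suc (2 ℕ.* suc k))) ≡ diam (seqA n L R (2 ℕ.* suc k)) + + n
    seqA-odd-diam k rewrite seqA-odd n L R k | seqA-even n L R (suc k) = OddTerm.diam-odd≡diam-even+N (+ suc k) (1≤+suc k)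

    seqA-even-diam : ∀ k → diam (seqA n L R (2 ℕ.* suc (suc k))) ≡ diam (seqA n L R (suc (2 ℕ.* suc k))) + + n
    seqA-even-diam k rewrite seqA-even n L R (suc (suc k)) | seqA-odd n L R k =
      OddTerm.diam-even-next≡diam-odd+N (+ suc k) (1≤+suc k)

    seqA-diam : (m : ℕ) → 3 ℕ.≤ m → diam (seqA n L R m) ≡ diam (seqA n L R (m ∸ 1)) + + n
    seqA-diam m 3≤m with parity m
    seqA-diam _ () | 2* zero
    seqA-diam _ (s≤s (s≤s ())) | 2* suc zero
    seqA-diam _ (s≤s ()) | 1+2* zero
    ... | 2* suc (suc k) =
      subst (λ j → diam (seqA n L R (2 ℕ.* suc (suc k))) ≡ diam (seqA n L R j) + + n)
            (sym (cong (_∸ 1) (2[1+k]≡2+2k (suc k)))) (seqA-even-diam k)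
    ... | 1+2* suc k = seqA-odd-diam k

open import Defs
open import Data.Nat as ℕ using (ℕ; suc; _≤_; _∸_)
open import Data.Integer using (ℤ; +_; _+_; _*_)
open import Data.List using (List; _++_)
open import Data.List.Membership.Propositional using (_∈_; _∉_)
open import Data.List.Relation.Unary.All using (All)
open import Data.Product using (_×_; _,_)
open import Relation.Binary.PropositionalEquality using (_≡_)

theorem2p8 : (n : ℕ) → 1 ≤ n → (L R : List ℤ) →
    All (λ x → (+ 1 Data.Integer.≤ x) × (x Data.Integer.≤ + n)) L →
    All (λ x → (+ (suc n) Data.Integer.≤ x) × (x Data.Integer.≤ + 2 * + n)) R →
    + 1 ∈ (L ++ R) → + 2 * + n ∈ (L ++ R) → + n ∉ (L ++ R) →
    IsP n (+ 1) (+ 2 * + n) (L ++ R) → MSTD (L ++ R) →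
    ((m : ℕ) → 1 ≤ m → seqA n L R m ⊆ˢ seqA n L R (suc m))
    × ((l : ℕ) → 1 ≤ l → MSTD (seqA n L R (2 ℕ.* l ∸ 1)))
    × ((l : ℕ) → 1 ≤ l → MDTS (seqA n L R (2 ℕ.* l)))
    × ((m : ℕ) → 3 ≤ m → diam (seqA n L R m) ≡ diam (seqA n L R (m ∸ 1)) + + n)
theorem2p8 n 1≤n L R L-bounds R-bounds 1∈A 2n∈A n∉A isP A-MSTD =
  seqA-⊆ , seqA-MSTD isP A-MSTD , seqA-MDTS , seqA-diam
  where open Sequence.SeqA n 1≤n L R L-bounds R-bounds 1∈A 2n∈A n∉A
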